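{- Let $(N,R),(N,G)$ be a pair of directed graphs on the same node set $N$ having property $P_2$, so that for every $a,b\in N$ there is a unique $c\in N$ with $(a,c)\in R$ and $(c,b)\in G$. Define $a*b=c$ for this $c$. Then $(N,*)$ is a rectangular groupoid.
   Context: Graphs are directed graphs with edge sets subsets of $N\times N$ (loops allowed). A groupoid $(A,*)$ is a rectangular groupoid if for all $a,b,c,d,x\in A$: $a*b=c*d=x$ implies $a*d=c*b=x$. -}

module Defs where

open import Level using (Level; _⊔_)
open import Data.Product using (Σ; _×_; _,_; proj₁; ∃!)
open import Relation.Binary.PropositionalEquality using (_≡_)

Graph : ∀ {n} → Set n → (e : Level) → Set (n ⊔ Level.suc e)
Graph N e = N → N → Set e

P₂ : ∀ {n e} {N : Set n} → Graph N e → Graph N e → Set (n ⊔ e)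
P₂ {N = N} R G = (a b : N) → ∃! _≡_ (λ c → R a c × G c b)

induced* : ∀ {n e} {N : Set n} (R G : Graph N e) → P₂ R G → N → N → N
induced* R G p a b = proj₁ (p a b)

IsRectangular : ∀ {n} {A : Set n} → (A → A → A) → Set n
IsRectangular {A = A} _*_ = (a b c d x : A) →
  a * b ≡ x → c * d ≡ x → (a * d ≡ x) × (c * b ≡ x)

module Submission where

-- Under property P₂, the product a * b is characterised as the
-- unique node c lying on an R-edge out of a and a G-edge into b.  Hence if
-- x = a * b then R a x (from the first factor) and G x b (from the second);
-- likewise x = c * d gives R c x and G x d.  Mixing the two, x sits on an
-- R-edge out of a and a G-edge into d, so uniqueness forces a * d = x; and
-- symmetrically c * b = x.

open import Defs
open import Data.Product using (_×_; _,_; proj₁; proj₂)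
open import Relation.Binary.PropositionalEquality using (_≡_; subst)

module _ {n e} {N : Set n} (R G : Graph N e) (p : P₂ R G) where

  private
    _*_ : N → N → N
    _*_ = induced* R G p

  *-witness : (a b : N) → R a (a * b) × G (a * b) b
  *-witness a b = proj₁ (proj₂ (p a b))

  *-unique : {a b c : N} → R a c → G c b → a * b ≡ c
  *-unique {a} {b} Rac Gcb = proj₂ (proj₂ (p a b)) (Rac , Gcb)

  R-from-left : {a b x : N} → a * b ≡ x → R a x
  R-from-left {a} {b} ab≡x = subst (R a) ab≡x (proj₁ (*-witness a b))

  G-to-right : {a b x : N} → a * b ≡ x → G x b
  G-to-right {a} {b} ab≡x = subst (λ z → G z b) ab≡x (proj₂ (*-witness a b))

  *-cross : {a b c d x : N} → a * b ≡ x → c * d ≡ x → a * d ≡ x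
  *-cross ab≡x cd≡x = *-unique (R-from-left ab≡x) (G-to-right cd≡x)

mainTheorem4 : ∀ {n e} {N : Set n} (R G : Graph N e) (p : P₂ R G) →
    IsRectangular (induced* R G p)
mainTheorem4 R G p a b c d x ab≡x cd≡x =
  *-cross R G p ab≡x cd≡x , *-cross R G p cd≡x ab≡x
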